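{- Every finite interval order is both a unit trapezoid order and a proper parallelogram order.
   Context: A trapezoid representation of an order uses two parallel baselines. Each element $x$ is assigned a closed interval $[l(x),r(x)]$ on the lower baseline and a closed interval $[L(x),R(x)]$ on the upper baseline, and its trapezoid $T_x$ is the convex hull of these two intervals. The representation requires $x\prec y$ if and only if $r(x)<l(y)$ and $R(x)<L(y)$. A unit trapezoid order is one having such a representation in which all trapezoids have equal area, equivalently the sum of the two base lengths is constant. A proper parallelogram order is one having such a representation with two properties: - each element's upper and lower intervals have equal length; - no trapezoid is properly contained in another. An interval order is an order representable by closed real intervals, with $x<y$ if and only if the interval of $x$ lies entirely to the left of that of $y$.
   Formalization: Interval orders are those represented by intervals with rational endpoints rather than real ones, and the trapezoid endpoints and the points used to test proper containment are taken in ℚ. -}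

module Defs where

open import Data.Nat using (ℕ)
open import Data.Fin using (Fin)
open import Data.Rational using (ℚ; 0ℚ; 1ℚ; _+_; _-_; _*_; _≤_; _<_)
open import Data.Product using (Σ; _×_; _,_; ∃)
open import Relation.Nullary using (¬_)
open import Function.Bundles using (_⇔_)
open import Relation.Binary.PropositionalEquality using (_≡_)
open import Relation.Binary.Structures using (IsStrictPartialOrder)

Rel : ℕ → Set₁
Rel n = Fin n → Fin n → Set

record IntervalRep {n : ℕ} (_≺_ : Rel n) : Set where
  field
    l r   : Fin n → ℚ
    l≤r   : ∀ x → l x ≤ r x
    repr  : ∀ x y → (x ≺ y) ⇔ (r x < l y)

IsIntervalOrder : {n : ℕ} → Rel n → Set
IsIntervalOrder _≺_ = IntervalRep _≺_

-- Trapezoid representation: lower baseline (height 0) interval [l x, r x],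
-- upper baseline (height 1) interval [L x, R x];
-- x ≺ y iff r x < l y and R x < L y.
record TrapezoidRep {n : ℕ} (_≺_ : Rel n) : Set where
  field
    l r L R : Fin n → ℚ
    l≤r     : ∀ x → l x ≤ r x
    L≤R     : ∀ x → L x ≤ R x
    repr    : ∀ x y → (x ≺ y) ⇔ (r x < l y × R x < L y)

module _ {n : ℕ} {_≺_ : Rel n} (T : TrapezoidRep _≺_) where
  open TrapezoidRep T

  -- The point (p, t) (horizontal coordinate p, height t, baselines at t = 0, 1)
  -- lies in the trapezoid T_x = convex hull of the two base intervals.
  InTrap : Fin n → ℚ → ℚ → Set
  InTrap x p t =
    (0ℚ ≤ t) × (t ≤ 1ℚ) ×
    (((1ℚ - t) * l x + t * L x) ≤ p) × (p ≤ ((1ℚ - t) * r x + t * R x))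

  TrapSubset : Fin n → Fin n → Set
  TrapSubset x y = ∀ p t → InTrap x p t → InTrap y p t

  ProperlyContained : Fin n → Fin n → Set
  ProperlyContained x y =
    TrapSubset x y × Σ ℚ (λ p → Σ ℚ (λ t → InTrap y p t × ¬ InTrap x p t))

-- Unit trapezoid order: a trapezoid representation in which the sum of the
-- two base lengths is constant (equivalently all trapezoids have equal area).
IsUnitTrapezoidOrder : {n : ℕ} → Rel n → Set
IsUnitTrapezoidOrder _≺_ =
  Σ (TrapezoidRep _≺_) λ T → let open TrapezoidRep T in
    Σ ℚ λ c → ∀ x → (r x - l x) + (R x - L x) ≡ c

IsProperParallelogramOrder : {n : ℕ} → Rel n → Set
IsProperParallelogramOrder _≺_ =
  Σ (TrapezoidRep _≺_) λ T → let open TrapezoidRep T in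
    (∀ x → r x - l x ≡ R x - L x) ×
    (∀ x y → ¬ ProperlyContained T x y)

{-# OPTIONS --safe #-}
module Submission where

-- Counting, for each endpoint of an interval representation, the right endpoints strictly
-- below it turns the representation into one by integer intervals [l x, r x] ⊆ [0, N],
-- which serve as lower bases.  For equal areas, let the upper base of x start at
-- (N+1)·r x and have length N − (r x − l x): as these lengths are below N+1, the upper
-- bases are ordered like the lower ones.  For parallelograms, shift [l x, r x] by
-- K·l x + r x with K > 2N; the shift is lexicographic in (l x, r x), so if both bases of
-- x are nested in those of y, then l x = l y and then r x = r y.

open import Defs
open import Data.Nat using (ℕ)
open import Data.Product using (_×_; _,_; proj₁; proj₂)
open import Relation.Binary.PropositionalEquality using (_≡_)
open import Relation.Binary.Structures using (IsStrictPartialOrder)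

open import Data.Nat as ℕ using (zero; suc; _∸_; s≤s; z≤n; z<s; s<s)
import Data.Nat.Properties as ℕ
open import Data.Fin using (Fin)
open import Data.List using (List; []; _∷_; map; length; allFin)
open import Data.List.Membership.Propositional using (_∈_)
open import Data.List.Membership.Propositional.Properties using (∈-map⁺; ∈-allFin)
open import Data.List.Relation.Unary.Any using (here; there)
open import Data.Rational using (ℚ; 0ℚ; 1ℚ; _+_; _-_; _*_; _≤_; _<_)
open import Data.Rational.Properties
  using (≤-refl; <-irrefl; <-≤-trans; <-trans; <⇒≤; ≰⇒>; _<?_; positive⁻¹;
         +-mono-≤; +-mono-<-≤; +-monoʳ-≤; +-monoʳ-<;
         +-identityˡ; +-identityʳ; *-identityˡ; *-zeroˡ)
open import Data.Rational.Solver using (module +-*-Solver)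
open import Function using (_∘_)
open import Function.Bundles using (_⇔_; mk⇔; Equivalence)
open import Relation.Nullary using (¬_; yes; no; contradiction)
open import Relation.Binary.PropositionalEquality
  using (refl; sym; trans; cong; cong₂; subst; subst₂; module ≡-Reasoning)

open Equivalence using (to; from)

fromℕ : ℕ → ℚ
fromℕ zero    = 0ℚ
fromℕ (suc m) = 1ℚ + fromℕ m

0≤fromℕ : ∀ m → 0ℚ ≤ fromℕ m
0≤fromℕ zero    = ≤-refl
0≤fromℕ (suc m) = +-mono-≤ (<⇒≤ (positive⁻¹ 1ℚ)) (0≤fromℕ m)

fromℕ-mono-≤ : ∀ {m k} → m ℕ.≤ k → fromℕ m ≤ fromℕ k
fromℕ-mono-≤ {k = k} z≤n = 0≤fromℕ k
fromℕ-mono-≤ (s≤s m≤k)   = +-monoʳ-≤ 1ℚ (fromℕ-mono-≤ m≤k)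

fromℕ-mono-< : ∀ {m k} → m ℕ.< k → fromℕ m < fromℕ k
fromℕ-mono-< {k = suc k} z<s = +-mono-<-≤ (positive⁻¹ 1ℚ) (0≤fromℕ k)
fromℕ-mono-< {suc m} {suc k} (s<s m<k) = +-monoʳ-< 1ℚ (fromℕ-mono-< m<k)

fromℕ-cancel-≤ : ∀ {m k} → fromℕ m ≤ fromℕ k → m ℕ.≤ k
fromℕ-cancel-≤ m≤k = ℕ.≮⇒≥ (λ k<m → <-irrefl refl (<-≤-trans (fromℕ-mono-< k<m) m≤k))

fromℕ-cancel-< : ∀ {m k} → fromℕ m < fromℕ k → m ℕ.< k
fromℕ-cancel-< m<k = ℕ.≰⇒> (λ k≤m → <-irrefl refl (<-≤-trans m<k (fromℕ-mono-≤ k≤m)))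

fromℕ-homo-+ : ∀ m k → fromℕ (m ℕ.+ k) ≡ fromℕ m + fromℕ k
fromℕ-homo-+ zero    k = sym (+-identityˡ (fromℕ k))
fromℕ-homo-+ (suc m) k = begin
  1ℚ + fromℕ (m ℕ.+ k)        ≡⟨ cong (1ℚ +_) (fromℕ-homo-+ m k) ⟩
  1ℚ + (fromℕ m + fromℕ k)    ≡⟨ solve 3 (λ a b c → a :+ (b :+ c) := (a :+ b) :+ c) refl 1ℚ (fromℕ m) (fromℕ k) ⟩
  (1ℚ + fromℕ m) + fromℕ k    ∎
  where open ≡-Reasoning; open +-*-Solver

fromℕ-homo-∸ : ∀ {m k} → k ℕ.≤ m → fromℕ (m ∸ k) ≡ fromℕ m - fromℕ k
fromℕ-homo-∸ {m} {k} k≤m = begin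
  fromℕ (m ∸ k)                          ≡⟨ solve 2 (λ a b → b := (a :+ b) :- a) refl (fromℕ k) (fromℕ (m ∸ k)) ⟩
  (fromℕ k + fromℕ (m ∸ k)) - fromℕ k    ≡⟨ cong (_- fromℕ k) (sym (fromℕ-homo-+ k (m ∸ k))) ⟩
  fromℕ (k ℕ.+ (m ∸ k)) - fromℕ k        ≡⟨ cong (λ j → fromℕ j - fromℕ k) (ℕ.m+[n∸m]≡n k≤m) ⟩
  fromℕ m - fromℕ k                      ∎
  where open ≡-Reasoning; open +-*-Solver

leading-<⇒< : ∀ {k d m n} → d ℕ.< k → m ℕ.< n → k ℕ.* m ℕ.+ d ℕ.< k ℕ.* n
leading-<⇒< {k} {d} {m} {n} d<k m<n = begin-strict
  k ℕ.* m ℕ.+ d    <⟨ ℕ.+-monoʳ-< (k ℕ.* m) d<k ⟩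
  k ℕ.* m ℕ.+ k    ≡⟨ ℕ.+-comm (k ℕ.* m) k ⟩
  k ℕ.+ k ℕ.* m    ≡⟨ ℕ.*-suc k m ⟨
  k ℕ.* suc m      ≤⟨ ℕ.*-monoʳ-≤ k m<n ⟩
  k ℕ.* n          ∎
  where open ℕ.≤-Reasoning

≤⇒leading-≤ : ∀ {k c d m n} → d ℕ.< k → k ℕ.* m ℕ.+ c ℕ.≤ k ℕ.* n ℕ.+ d → m ℕ.≤ n
≤⇒leading-≤ {k} {c} {d} {m} {n} d<k km+c≤kn+d = ℕ.≮⇒≥ λ n<m →
  ℕ.<⇒≱ (ℕ.<-≤-trans (leading-<⇒< d<k n<m) (ℕ.m≤m+n (k ℕ.* m) c)) km+c≤kn+d

lexicographic-nested⇒≡ : ∀ k {a b a′ b′} → b′ ℕ.+ b′ ℕ.< k → a′ ℕ.≤ a → b ℕ.≤ b′ →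
  (k ℕ.* a′ ℕ.+ b′) ℕ.+ a′ ℕ.≤ (k ℕ.* a ℕ.+ b) ℕ.+ a →
  (k ℕ.* a ℕ.+ b) ℕ.+ b ℕ.≤ (k ℕ.* a′ ℕ.+ b′) ℕ.+ b′ →
  a ≡ a′ × b ≡ b′
lexicographic-nested⇒≡ k {a} {b} {a′} {b′} b′+b′<k a′≤a b≤b′ lower-nested upper-nested
  with refl ← ℕ.≤-antisym (≤⇒leading-≤ b′+b′<k (subst₂ ℕ._≤_ (ℕ.+-assoc (k ℕ.* a) b b)
                                                 (ℕ.+-assoc (k ℕ.* a′) b′ b′) upper-nested)) a′≤a
  = refl , ℕ.≤-antisym b≤b′ (ℕ.+-cancelˡ-≤ (k ℕ.* a) b′ b (ℕ.+-cancelʳ-≤ a _ _ lower-nested))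

rank : List ℚ → ℚ → ℕ
rank []      v = 0
rank (e ∷ E) v with e <? v
... | yes _ = suc (rank E v)
... | no  _ = rank E v

rank≤length : ∀ E v → rank E v ℕ.≤ length E
rank≤length []      v = z≤n
rank≤length (e ∷ E) v with e <? v
... | yes _ = s≤s (rank≤length E v)
... | no  _ = ℕ.m≤n⇒m≤1+n (rank≤length E v)

rank-mono-≤ : ∀ E {v w} → v ≤ w → rank E v ℕ.≤ rank E w
rank-mono-≤ []      v≤w = z≤n
rank-mono-≤ (e ∷ E) {v} {w} v≤w with e <? v | e <? w
... | yes _   | yes _   = s≤s (rank-mono-≤ E v≤w)
... | yes e<v | no  e≮w = contradiction (<-≤-trans e<v v≤w) e≮w
... | no  _   | yes _   = ℕ.m≤n⇒m≤1+n (rank-mono-≤ E v≤w)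
... | no  _   | no  _   = rank-mono-≤ E v≤w

rank-mono-< : ∀ {E v w} → v ∈ E → v < w → rank E v ℕ.< rank E w
rank-mono-< {v ∷ E} {v} {w} (here refl) v<w with v <? v | v <? w
... | yes v<v | _       = contradiction v<v (<-irrefl refl)
... | no  _   | yes _   = s≤s (rank-mono-≤ E (<⇒≤ v<w))
... | no  _   | no  v≮w = contradiction v<w v≮w
rank-mono-< {e ∷ E} {v} {w} (there v∈E) v<w with e <? v | e <? w
... | yes _   | yes _   = s≤s (rank-mono-< v∈E v<w)
... | yes e<v | no  e≮w = contradiction (<-trans e<v v<w) e≮w
... | no  _   | yes _   = ℕ.m≤n⇒m≤1+n (rank-mono-< v∈E v<w)
... | no  _   | no  _   = rank-mono-< v∈E v<w

record ℕIntervalRep {n : ℕ} (_≺_ : Rel n) : Set where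
  field
    bound   : ℕ
    l r     : Fin n → ℕ
    l≤r     : ∀ x → l x ℕ.≤ r x
    r≤bound : ∀ x → r x ℕ.≤ bound
    repr    : ∀ x y → (x ≺ y) ⇔ (r x ℕ.< l y)

discretise : ∀ {n} {_≺_ : Rel n} → IntervalRep _≺_ → ℕIntervalRep _≺_
discretise {n} I = record
  { bound   = length E
  ; l       = rank E ∘ l
  ; r       = rank E ∘ r
  ; l≤r     = λ x → rank-mono-≤ E (l≤r x)
  ; r≤bound = λ x → rank≤length E (r x)
  ; repr    = λ x y → mk⇔
      (λ x≺y → rank-mono-< (∈-map⁺ r (∈-allFin x)) (to (repr x y) x≺y))
      (λ rank<rank → from (repr x y) (≰⇒> λ ly≤rx →
         ℕ.<⇒≱ rank<rank (rank-mono-≤ E ly≤rx)))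
  }
  where
    open IntervalRep I
    E : List ℚ
    E = map r (allFin n)

module _ {n : ℕ} {_≺_ : Rel n} (T : TrapezoidRep _≺_) where
  open TrapezoidRep T

  private
    height-0 : ∀ u w → (1ℚ - 0ℚ) * u + 0ℚ * w ≡ u
    height-0 u w = trans (cong₂ _+_ (*-identityˡ u) (*-zeroˡ w)) (+-identityʳ u)

    height-1 : ∀ u w → (1ℚ - 1ℚ) * u + 1ℚ * w ≡ w
    height-1 u w = trans (cong₂ _+_ (*-zeroˡ u) (*-identityˡ w)) (+-identityˡ w)

    0≤1 : 0ℚ ≤ 1ℚ
    0≤1 = <⇒≤ (positive⁻¹ 1ℚ)

  InTrap-bottom : ∀ {x p} → InTrap T x p 0ℚ ⇔ (l x ≤ p × p ≤ r x)
  InTrap-bottom {x} {p} = mk⇔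
    (λ (_ , _ , lo , hi) → subst (_≤ p) (height-0 (l x) (L x)) lo
                         , subst (p ≤_) (height-0 (r x) (R x)) hi)
    (λ (lo , hi) → ≤-refl , 0≤1
                 , subst (_≤ p) (sym (height-0 (l x) (L x))) lo
                 , subst (p ≤_) (sym (height-0 (r x) (R x))) hi)

  InTrap-top : ∀ {x p} → InTrap T x p 1ℚ ⇔ (L x ≤ p × p ≤ R x)
  InTrap-top {x} {p} = mk⇔
    (λ (_ , _ , lo , hi) → subst (_≤ p) (height-1 (l x) (L x)) lo
                         , subst (p ≤_) (height-1 (r x) (R x)) hi)
    (λ (lo , hi) → 0≤1 , ≤-refl
                 , subst (_≤ p) (sym (height-1 (l x) (L x))) lo
                 , subst (p ≤_) (sym (height-1 (r x) (R x))) hi)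

  ⊆⇒bases-nested : ∀ {x y} → TrapSubset T x y →
                   (l y ≤ l x × r x ≤ r y) × (L y ≤ L x × R x ≤ R y)
  ⊆⇒bases-nested {x} {y} Tx⊆Ty =
      (proj₁ (bottom (l x) ≤-refl (l≤r x)) , proj₂ (bottom (r x) (l≤r x) ≤-refl))
    , (proj₁ (top (L x) ≤-refl (L≤R x))    , proj₂ (top (R x) (L≤R x) ≤-refl))
    where
      bottom : ∀ p → l x ≤ p → p ≤ r x → l y ≤ p × p ≤ r y
      bottom p lo hi = to InTrap-bottom (Tx⊆Ty p 0ℚ (from InTrap-bottom (lo , hi)))
      top : ∀ p → L x ≤ p → p ≤ R x → L y ≤ p × p ≤ R y
      top p lo hi = to InTrap-top (Tx⊆Ty p 1ℚ (from InTrap-top (lo , hi)))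

  equal-bases⇒¬⊊ : ∀ {x y} → l x ≡ l y → r x ≡ r y → L x ≡ L y → R x ≡ R y →
                   ¬ ProperlyContained T x y
  equal-bases⇒¬⊊ l≡ r≡ L≡ R≡ (_ , p , t , (0≤t , t≤1 , lo , hi) , ∉Tx) = ∉Tx
    ( 0≤t , t≤1
    , subst₂ (λ u U → (1ℚ - t) * u + t * U ≤ p) (sym l≡) (sym L≡) lo
    , subst₂ (λ u U → p ≤ (1ℚ - t) * u + t * U) (sym r≡) (sym R≡) hi )

module _ {n : ℕ} {_≺_ : Rel n} (D : ℕIntervalRep _≺_) where
  open ℕIntervalRep D

  withUpperBases : (L R : Fin n → ℕ) → (∀ x → L x ℕ.≤ R x) →
                   (∀ {x y} → r x ℕ.< l y → R x ℕ.< L y) → TrapezoidRep _≺_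
  withUpperBases L R L≤R upper-< = record
    { l = fromℕ ∘ l ; r = fromℕ ∘ r ; L = fromℕ ∘ L ; R = fromℕ ∘ R
    ; l≤r  = fromℕ-mono-≤ ∘ l≤r
    ; L≤R  = fromℕ-mono-≤ ∘ L≤R
    ; repr = λ x y → mk⇔
        (λ x≺y → let rx<ly = to (repr x y) x≺y in fromℕ-mono-< rx<ly , fromℕ-mono-< (upper-< rx<ly))
        (λ (rx<ly , _) → from (repr x y) (fromℕ-cancel-< rx<ly))
    }

  unitTrapezoid : IsUnitTrapezoidOrder _≺_
  unitTrapezoid = withUpperBases L R (λ x → ℕ.m≤m+n (L x) _) upper-< , fromℕ bound , lengths-sum
    where
      len : Fin n → ℕ
      len x = r x ∸ l x
      L R : Fin n → ℕ
      L x = suc bound ℕ.* r x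
      R x = L x ℕ.+ (bound ∸ len x)

      upper-< : ∀ {x y} → r x ℕ.< l y → R x ℕ.< L y
      upper-< {x} {y} rx<ly =
        leading-<⇒< (s≤s (ℕ.m∸n≤m bound (len x))) (ℕ.<-≤-trans rx<ly (l≤r y))

      lengths-sum : ∀ x → (fromℕ (r x) - fromℕ (l x)) + (fromℕ (R x) - fromℕ (L x)) ≡ fromℕ bound
      lengths-sum x = begin
        (fromℕ (r x) - fromℕ (l x)) + (fromℕ (R x) - fromℕ (L x))
          ≡⟨ cong₂ _+_ (fromℕ-homo-∸ (l≤r x)) (fromℕ-homo-∸ (ℕ.m≤m+n (L x) _)) ⟨
        fromℕ (len x) + fromℕ (R x ∸ L x)
          ≡⟨ fromℕ-homo-+ (len x) (R x ∸ L x) ⟨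
        fromℕ (len x ℕ.+ (R x ∸ L x))
          ≡⟨ cong (λ d → fromℕ (len x ℕ.+ d)) (ℕ.m+n∸m≡n (L x) (bound ∸ len x)) ⟩
        fromℕ (len x ℕ.+ (bound ∸ len x))
          ≡⟨ cong fromℕ (ℕ.m+[n∸m]≡n (ℕ.≤-trans (ℕ.m∸n≤m (r x) (l x)) (r≤bound x))) ⟩
        fromℕ bound ∎
        where open ≡-Reasoning

  properParallelogram : IsProperParallelogramOrder _≺_
  properParallelogram = T , equal-lengths , no-proper-containment
    where
      K : ℕ
      K = suc (bound ℕ.+ bound)
      shift L R : Fin n → ℕ
      shift x = K ℕ.* l x ℕ.+ r x
      L x = shift x ℕ.+ l x
      R x = shift x ℕ.+ r x

      L≤R : ∀ x → L x ℕ.≤ R x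
      L≤R x = ℕ.+-monoʳ-≤ (shift x) (l≤r x)

      upper-< : ∀ {x y} → r x ℕ.< l y → R x ℕ.< L y
      upper-< {x} {y} rx<ly = ℕ.+-mono-≤-< (ℕ.+-mono-≤ (ℕ.*-monoʳ-≤ K lx≤ly) rx≤ry) rx<ly
        where
          lx≤ly = ℕ.≤-trans (l≤r x) (ℕ.<⇒≤ rx<ly)
          rx≤ry = ℕ.≤-trans (ℕ.<⇒≤ rx<ly) (l≤r y)

      T : TrapezoidRep _≺_
      T = withUpperBases L R L≤R upper-<

      equal-lengths : ∀ x → fromℕ (r x) - fromℕ (l x) ≡ fromℕ (R x) - fromℕ (L x)
      equal-lengths x = begin
        fromℕ (r x) - fromℕ (l x)  ≡⟨ fromℕ-homo-∸ (l≤r x) ⟨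
        fromℕ (r x ∸ l x)          ≡⟨ cong fromℕ (ℕ.[m+n]∸[m+o]≡n∸o (shift x) (r x) (l x)) ⟨
        fromℕ (R x ∸ L x)          ≡⟨ fromℕ-homo-∸ (L≤R x) ⟩
        fromℕ (R x) - fromℕ (L x)  ∎
        where open ≡-Reasoning

      no-proper-containment : ∀ x y → ¬ ProperlyContained T x y
      no-proper-containment x y Tx⊊Ty@(Tx⊆Ty , _)
        with ((ly≤lx , rx≤ry) , (Ly≤Lx , Rx≤Ry)) ← ⊆⇒bases-nested T Tx⊆Ty
        with lexicographic-nested⇒≡ K {l x} {r x} {l y} {r y}
               (s≤s (ℕ.+-mono-≤ (r≤bound y) (r≤bound y)))
               (fromℕ-cancel-≤ ly≤lx) (fromℕ-cancel-≤ rx≤ry)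
               (fromℕ-cancel-≤ Ly≤Lx) (fromℕ-cancel-≤ Rx≤Ry)
      ... | lx≡ly , rx≡ry = equal-bases⇒¬⊊ T (cong fromℕ lx≡ly) (cong fromℕ rx≡ry)
                              (cong₂ (λ a b → fromℕ ((K ℕ.* a ℕ.+ b) ℕ.+ a)) lx≡ly rx≡ry)
                              (cong₂ (λ a b → fromℕ ((K ℕ.* a ℕ.+ b) ℕ.+ b)) lx≡ly rx≡ry)
                              Tx⊊Ty

theorem7 : (n : ℕ) (_≺_ : Rel n) → IsStrictPartialOrder _≡_ _≺_ → IsIntervalOrder _≺_ →
    IsUnitTrapezoidOrder _≺_ × IsProperParallelogramOrder _≺_
theorem7 n _≺_ _ I = unitTrapezoid D , properParallelogram D
  where
    D : ℕIntervalRep _≺_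
    D = discretise I
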